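{- Let $M=(X,rk)$ be a matroid without loops and coloops. (1) If $rk(M)=1$, then $\sum_{A\subseteq X,|A|\ge2}(-1)^{|A|}(|A|-1)=1$. (2) If $rk(M)=1$ and $|X|\ge3$, then $\sum_{A\subseteq X,|A|\ge3}(-1)^{|A|+1}\binom{|A|-1}{2}=1$. (3) If $rk(M)=2$, then $\sum_{A\subseteq X}(-1)^{|A|+1}(|A|-rk(A))=p(M)-2$. (4) If $rk(M)=2$, then $\sum_{A\subseteq X}(-1)^{|A|}\binom{|A|-rk(A)}{2}$ equals $1$ if $p(M)=2$, and equals $p'(M)$ if $p(M)=3$.
   Context: A matroid $(X,rk)$ is a finite set with rank function $rk:2^X\to\mathbb{Z}_{\ge0}$ satisfying $rk(A)\le|A|$, monotonicity and submodularity; $rk(M)=rk(X)$. A loop is an element $e$ with $rk(\{e\})=0$; a coloop is an element $e$ with $rk(X\setminus\{e\})=rk(X)-1$. Elements $e,f$ are parallel if $rk(\{e,f\})=rk(\{e\})=rk(\{f\})=1$; a parallel class is a maximal set of non-loop elements pairwise parallel, non-trivial if it has at least two elements. $p(M)$ is the number of parallel classes and $p'(M)$ the number of non-trivial parallel classes. -}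

module Defs where

open import Data.Bool using (Bool; true; false; _∧_; _∨_; not; if_then_else_)
open import Data.Nat using (ℕ; zero; suc; _≤_; _+_; _∸_; _≡ᵇ_; _≤ᵇ_)
open import Data.Integer using (ℤ; +_; -_) renaming (_+_ to _+ℤ_; _*_ to _*ℤ_)
open import Data.Fin using (Fin)
open import Data.Fin.Subset using (Subset; _⊆_; _∪_; _∩_; ∁; ⁅_⁆; ∣_∣) renaming (⊤ to full)
open import Data.Vec using ([]; _∷_; lookup)
open import Data.List.Base using (List; []; _∷_; _++_; map; foldr; allFin)
open import Relation.Binary.PropositionalEquality using (_≡_)

record Matroid : Set where
  field
    n      : ℕ
    rk     : Subset n → ℕ
    rk-≤   : ∀ A → rk A ≤ ∣ A ∣
    rk-mono : ∀ {A B} → A ⊆ B → rk A ≤ rk B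
    rk-sub : ∀ A B → rk (A ∪ B) + rk (A ∩ B) ≤ rk A + rk B

open Matroid public

rank : (M : Matroid) → ℕ
rank M = rk M full

IsLoop : (M : Matroid) → Fin (n M) → Set
IsLoop M e = rk M ⁅ e ⁆ ≡ 0

-- coloop: rk(X \ {e}) = rk(X) - 1   (written additively)
IsColoop : (M : Matroid) → Fin (n M) → Set
IsColoop M e = rk M (∁ ⁅ e ⁆) + 1 ≡ rank M

allSubsets : ∀ m → List (Subset m)
allSubsets zero = [] ∷ []
allSubsets (suc m) = map (false ∷_) (allSubsets m) ++ map (true ∷_) (allSubsets m)

every : {A : Set} → (A → Bool) → List A → Bool
every P = foldr (λ x b → P x ∧ b) true

ΣSub : ∀ m → (Subset m → ℤ) → ℤ
ΣSub m f = foldr (λ A acc → f A +ℤ acc) (+ 0) (allSubsets m)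

sgn : ℕ → ℤ
sgn zero = + 1
sgn (suc k) = - sgn k

countSub : ∀ m → (Subset m → Bool) → ℕ
countSub m P = foldr (λ A acc → if P A then suc acc else acc) 0 (allSubsets m)

parallel? : (M : Matroid) → Fin (n M) → Fin (n M) → Bool
parallel? M e f = (rk M (⁅ e ⁆ ∪ ⁅ f ⁆) ≡ᵇ 1) ∧ (rk M ⁅ e ⁆ ≡ᵇ 1) ∧ (rk M ⁅ f ⁆ ≡ᵇ 1)

-- S consists of non-loop elements that are pairwise parallel
-- (the case e = f encodes rk({e}) = 1, i.e. e is not a loop)
pairwiseParallel? : (M : Matroid) → Subset (n M) → Bool
pairwiseParallel? M S =
  every (λ e → every (λ f → not (lookup S e ∧ lookup S f) ∨ parallel? M e f) (allFin (n M))) (allFin (n M))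

parallelClass? : (M : Matroid) → Subset (n M) → Bool
parallelClass? M S =
  (1 ≤ᵇ ∣ S ∣) ∧ pairwiseParallel? M S
  ∧ every (λ g → lookup S g ∨ not (pairwiseParallel? M (S ∪ ⁅ g ⁆))) (allFin (n M))

p : Matroid → ℕ
p M = countSub (n M) (parallelClass? M)

p' : Matroid → ℕ
p' M = countSub (n M) (λ S → parallelClass? M S ∧ (2 ≤ᵇ ∣ S ∣))

-- Every sum is Σ_{A ⊆ X} F(|A|, rk A).  A function of |A| alone is a combination of the
-- (-1)^|A| (|A| C j) plus a correction at A = ∅, and Σ_A (-1)^|A| (|A| C j) = 0 for j < |X|;
-- this gives (1) and (2), the absence of coloops serving only to make |X| > rk M.
-- In a loopless matroid of rank 2, rk A = 0 only for A = ∅, and rk A = 1 exactly when A is a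
-- nonempty subset of a parallel class, which is then unique.  So the sum splits into a part
-- depending on |A| only, the correction at ∅, and, for each parallel class S, the sum of the
-- rank-one correction over the nonempty B ⊆ S; the latter is 1 for (3), and 1 or 2 for (4)
-- according as |S| = 1 or |S| ≥ 2.  If p(M) = 2 no class is a singleton {e}: as e is not a
-- coloop, X ∖ e has rank 2, so it contains two non-parallel elements, and their classes
-- together with {e} would be three.

module Submission where

open import Defs
open import Data.Bool using (Bool; true; false; T; if_then_else_; _∧_; _∨_; not)
import Data.Bool.Properties as Bool
open import Data.Empty using (⊥-elim)
open import Data.Fin using (Fin; fromℕ<)
open import Data.Fin.Properties using (¬∀⟶∃¬; all?)
open import Data.Fin.Subset using (Subset; ∣_∣; _∈_; _⊆_; _∪_; _∩_; ∁; ⁅_⁆; Nonempty)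
  renaming (⊤ to full; ⊥ to ∅)
open import Data.Fin.Subset.Properties
  using ( _⊆?_; ⊆⊤; ⊆-antisym; ∈⊤; x∈⁅x⁆; x∈⁅y⁆⇒x≡y; x∉⁅y⁆⇒x≢y; x∈∁p⇒x∉p; x∈p∪q⁺; x∈p∪q⁻; x∈p∩q⁺
        ; x∈p∧x≢y⇒x∈p-y; nonempty?; Empty-unique; p∪∁p≡⊤
        ; ∣⊥∣≡0; ∣⊤∣≡n; ∣⁅x⁆∣≡1; p⊆q⇒∣p∣≤∣q∣; p⊂q⇒∣p∣<∣q∣; x∈p⇒∣p-x∣<∣p∣ )
open import Data.Integer using (ℤ; +_; -_) renaming (_+_ to _+ℤ_; _*_ to _*ℤ_; _-_ to _-ℤ_)
import Data.Integer.Properties as ℤ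
open import Data.Integer.Tactic.RingSolver using (solve-∀)
open import Data.List using (List; []; _∷_; _++_; map; foldr; length; allFin)
import Data.List.Membership.Propositional as List
open import Data.List.Membership.Propositional.Properties using (∈-allFin)
open import Data.List.Relation.Unary.All using (All; []; _∷_)
import Data.List.Relation.Unary.All.Properties as All
open import Data.List.Relation.Unary.Any using (here; there)
open import Data.Nat using (ℕ; zero; suc; _≤_; _<_; _∸_; _≤ᵇ_; z≤n; s≤s) renaming (_+_ to _+ℕ_)
import Data.Nat.Properties as ℕ
open import Data.Nat.Combinatorics using (_C_; nCk+nC[k+1]≡[n+1]C[k+1]; nC1≡n)
open import Data.Product using (_×_; _,_; proj₁; proj₂; ∃₂)
open import Data.Sum using (inj₁; inj₂)
open import Data.Unit using (tt)
open import Data.Vec using (_∷_; []; lookup; tabulate)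
import Data.Vec.Properties as Vec
open import Function using (id; _∘_; case_of_; _⇔_; mk⇔; Equivalence)
open Equivalence using (to; from)
open import Relation.Binary using (DecidableEquality)
open import Relation.Binary.PropositionalEquality
open import Relation.Nullary using (¬_; Dec; does; yes; no)
open import Relation.Nullary.Decidable using (T?)

-- Unlike isYes (and hence True/toWitness), does computes through Dec.map, which ΣSub-⊆ needs.
T-does : ∀ {P : Set} (P? : Dec P) → T (does P?) ⇔ P
T-does (yes p) = mk⇔ (λ _ → p) (λ _ → tt)
T-does (no ¬p) = mk⇔ (λ ()) ¬p

T-every : ∀ {A : Set} {P : A → Bool} xs → T (every P xs) ⇔ All (T ∘ P) xs
T-every []       = mk⇔ (λ _ → []) (λ _ → tt)
T-every (x ∷ xs) = mk⇔
  (λ t → let Px , rest = to Bool.T-∧ t in Px ∷ to (T-every xs) rest)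
  (λ { (Px ∷ rest) → from Bool.T-∧ (Px , from (T-every xs) rest) })

T-every-allFin : ∀ {m} {P : Fin m → Bool} → T (every P (allFin m)) ⇔ (∀ i → T (P i))
T-every-allFin {m} = mk⇔ (All.tabulate⁻ ∘ to (T-every (allFin m)))
                         (from (T-every (allFin m)) ∘ All.tabulate⁺)

T-not∧∨ : ∀ {a b c} → T (not (a ∧ b) ∨ c) ⇔ (T a → T b → T c)
T-not∧∨ {true}  {true}  = mk⇔ (λ c _ _ → c) (λ f → f tt tt)
T-not∧∨ {true}  {false} = mk⇔ (λ _ _ ()) (λ _ → tt)
T-not∧∨ {false}         = mk⇔ (λ _ ()) (λ _ → tt)

T-∨not : ∀ {a b} → T (a ∨ not b) ⇔ (T b → T a)
T-∨not {true}          = mk⇔ (λ _ _ → tt) (λ _ → tt)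
T-∨not {false} {true}  = mk⇔ (λ ()) (λ f → f tt)
T-∨not {false} {false} = mk⇔ (λ _ ()) (λ _ → tt)

¬T-not∧∨ : ∀ {a b c} → ¬ T (not (a ∧ b) ∨ c) → T a × T b × ¬ T c
¬T-not∧∨ {true}  {true}  ¬t = tt , tt , ¬t
¬T-not∧∨ {true}  {false}     ¬t = ⊥-elim (¬t tt)
¬T-not∧∨ {false}             ¬t = ⊥-elim (¬t tt)

∈⇔T-lookup : ∀ {m} {S : Subset m} {x} → x ∈ S ⇔ T (lookup S x)
∈⇔T-lookup {S = S} {x} = mk⇔ (from Bool.T-≡ ∘ Vec.[]=⇒lookup)
                               (Vec.lookup⇒[]= x S ∘ to Bool.T-≡)

⁅⁆⊆ : ∀ {m} {A : Subset m} {x} → x ∈ A → ⁅ x ⁆ ⊆ A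
⁅⁆⊆ {x = x} x∈A y∈⁅x⁆ = subst (_∈ _) (sym (x∈⁅y⁆⇒x≡y x y∈⁅x⁆)) x∈A

∪-⊆ : ∀ {m} {X Y Z : Subset m} → X ⊆ Z → Y ⊆ Z → X ∪ Y ⊆ Z
∪-⊆ {X = X} {Y} X⊆Z Y⊆Z x∈X∪Y with x∈p∪q⁻ X Y x∈X∪Y
... | inj₁ x∈X = X⊆Z x∈X
... | inj₂ x∈Y = Y⊆Z x∈Y

∈⇒1≤∣∣ : ∀ {m} {S : Subset m} {x} → x ∈ S → 1 ≤ ∣ S ∣
∈⇒1≤∣∣ {x = x} x∈S = subst (_≤ _) (∣⁅x⁆∣≡1 x) (p⊆q⇒∣p∣≤∣q∣ (⁅⁆⊆ x∈S))

1≤∣∣⇒Nonempty : ∀ {m} (S : Subset m) → 1 ≤ ∣ S ∣ → Nonempty S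
1≤∣∣⇒Nonempty {m} S 1≤∣S∣ with nonempty? S
... | yes S≠∅ = S≠∅
... | no  S=∅ = ⊥-elim (ℕ.<⇒≱ 1≤∣S∣ (ℕ.≤-reflexive (trans (cong ∣_∣ (Empty-unique S=∅)) (∣⊥∣≡0 m))))

2≤∣∣ : ∀ {m} {S : Subset m} {x y} → x ∈ S → y ∈ S → x ≢ y → 2 ≤ ∣ S ∣
2≤∣∣ x∈S y∈S x≢y =
  ℕ.≤-trans (s≤s (∈⇒1≤∣∣ (x∈p∧x≢y⇒x∈p-y y∈S (x≢y ∘ sym)))) (x∈p⇒∣p-x∣<∣p∣ x∈S)

_≟ˢ_ : ∀ {m} → DecidableEquality (Subset m)
_≟ˢ_ = Vec.≡-dec Bool._≟_

sumBy : {A : Set} → (A → ℤ) → List A → ℤ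
sumBy f = foldr (λ x acc → f x +ℤ acc) (+ 0)

countBy : {A : Set} → (A → Bool) → List A → ℕ
countBy P = foldr (λ x acc → if P x then suc acc else acc) 0

module _ {A : Set} where

  sumBy-cong : ∀ {f g : A → ℤ} xs → (∀ x → f x ≡ g x) → sumBy f xs ≡ sumBy g xs
  sumBy-cong []       f≗g = refl
  sumBy-cong (x ∷ xs) f≗g = cong₂ _+ℤ_ (f≗g x) (sumBy-cong xs f≗g)

  sumBy-++ : ∀ (f : A → ℤ) xs ys → sumBy f (xs ++ ys) ≡ sumBy f xs +ℤ sumBy f ys
  sumBy-++ f []       ys = sym (ℤ.+-identityˡ _)
  sumBy-++ f (x ∷ xs) ys = trans (cong (f x +ℤ_) (sumBy-++ f xs ys)) (sym (ℤ.+-assoc (f x) _ _))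

  sumBy-zero : ∀ xs → sumBy (λ (_ : A) → + 0) xs ≡ + 0
  sumBy-zero []       = refl
  sumBy-zero (x ∷ xs) = trans (ℤ.+-identityˡ _) (sumBy-zero xs)

  sumBy-+ : ∀ (f g : A → ℤ) xs → sumBy (λ x → f x +ℤ g x) xs ≡ sumBy f xs +ℤ sumBy g xs
  sumBy-+ f g []       = refl
  sumBy-+ f g (x ∷ xs) rewrite sumBy-+ f g xs = interchange (f x) (g x) (sumBy f xs) (sumBy g xs)
    where
    interchange : ∀ a b c d → (a +ℤ b) +ℤ (c +ℤ d) ≡ (a +ℤ c) +ℤ (b +ℤ d)
    interchange = solve-∀

  sumBy-* : ∀ c (f : A → ℤ) xs → sumBy (λ x → c *ℤ f x) xs ≡ c *ℤ sumBy f xs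
  sumBy-* c f []       = sym (ℤ.*-zeroʳ c)
  sumBy-* c f (x ∷ xs) = trans (cong (c *ℤ f x +ℤ_) (sumBy-* c f xs)) (sym (ℤ.*-distribˡ-+ c (f x) _))

  sumBy-if : ∀ (P : A → Bool) c xs → sumBy (λ x → if P x then c else + 0) xs ≡ c *ℤ + countBy P xs
  sumBy-if P c []       = sym (ℤ.*-zeroʳ c)
  sumBy-if P c (x ∷ xs) with P x
  ... | true  = trans (cong (c +ℤ_) (sumBy-if P c xs)) (one-more c (+ countBy P xs))
    where
    one-more : ∀ c x → c +ℤ c *ℤ x ≡ c *ℤ (+ 1 +ℤ x)
    one-more = solve-∀
  ... | false = trans (ℤ.+-identityˡ _) (sumBy-if P c xs)

  countBy-++ : ∀ (P : A → Bool) xs ys → countBy P (xs ++ ys) ≡ countBy P xs +ℕ countBy P ys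
  countBy-++ P []       ys = refl
  countBy-++ P (x ∷ xs) ys with P x
  ... | true  = cong suc (countBy-++ P xs ys)
  ... | false = countBy-++ P xs ys

  countBy-cong : ∀ {P Q : A → Bool} xs → (∀ x → P x ≡ Q x) → countBy P xs ≡ countBy Q xs
  countBy-cong {P} {Q} []       P≗Q = refl
  countBy-cong {P} {Q} (x ∷ xs) P≗Q rewrite P≗Q x with Q x
  ... | true  = cong suc (countBy-cong xs P≗Q)
  ... | false = countBy-cong xs P≗Q

  countBy-split : ∀ (P Q : A → Bool) xs →
    countBy P xs ≡ countBy (λ x → P x ∧ Q x) xs +ℕ countBy (λ x → P x ∧ not (Q x)) xs
  countBy-split P Q []       = refl
  countBy-split P Q (x ∷ xs) with P x | Q x
  ... | true  | true  = cong suc (countBy-split P Q xs)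
  ... | true  | false = trans (cong suc (countBy-split P Q xs)) (sym (ℕ.+-suc _ _))
  ... | false | _     = countBy-split P Q xs

module _ {A B : Set} where

  sumBy-map : ∀ (f : A → ℤ) (g : B → A) xs → sumBy f (map g xs) ≡ sumBy (λ x → f (g x)) xs
  sumBy-map f g []       = refl
  sumBy-map f g (x ∷ xs) = cong (f (g x) +ℤ_) (sumBy-map f g xs)

  countBy-map : ∀ (P : A → Bool) (g : B → A) xs → countBy P (map g xs) ≡ countBy (λ x → P (g x)) xs
  countBy-map P g []       = refl
  countBy-map P g (x ∷ xs) with P (g x)
  ... | true  = cong suc (countBy-map P g xs)
  ... | false = countBy-map P g xs

  sumBy-comm : ∀ (f : A → B → ℤ) xs ys →
    sumBy (λ x → sumBy (f x) ys) xs ≡ sumBy (λ y → sumBy (λ x → f x y) xs) ys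
  sumBy-comm f []       ys = sym (sumBy-zero ys)
  sumBy-comm f (x ∷ xs) ys = trans (cong (sumBy (f x) ys +ℤ_) (sumBy-comm f xs ys))
                                   (sym (sumBy-+ (f x) (λ y → sumBy (λ x′ → f x′ y) xs) ys))

ΣSub-suc : ∀ m (f : Subset (suc m) → ℤ) →
  ΣSub (suc m) f ≡ ΣSub m (λ A → f (false ∷ A)) +ℤ ΣSub m (λ A → f (true ∷ A))
ΣSub-suc m f = trans (sumBy-++ f (map (false ∷_) (allSubsets m)) _)
  (cong₂ _+ℤ_ (sumBy-map f (false ∷_) (allSubsets m)) (sumBy-map f (true ∷_) (allSubsets m)))

countSub-suc : ∀ m (P : Subset (suc m) → Bool) →
  countSub (suc m) P ≡ countSub m (λ A → P (false ∷ A)) +ℕ countSub m (λ A → P (true ∷ A))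
countSub-suc m P = trans (countBy-++ P (map (false ∷_) (allSubsets m)) _)
  (cong₂ _+ℕ_ (countBy-map P (false ∷_) (allSubsets m)) (countBy-map P (true ∷_) (allSubsets m)))

ΣSub-cong : ∀ m {f g : Subset m → ℤ} → (∀ A → f A ≡ g A) → ΣSub m f ≡ ΣSub m g
ΣSub-cong m = sumBy-cong (allSubsets m)

ΣSub-indicator : ∀ m (P : Subset m → Bool) → ΣSub m (λ S → if P S then + 1 else + 0) ≡ + countSub m P
ΣSub-indicator m P = trans (sumBy-if P (+ 1) (allSubsets m)) (ℤ.*-identityˡ _)

ΣSize : ℕ → (ℕ → ℤ) → ℤ
ΣSize m h = ΣSub m (λ A → h ∣ A ∣)

ΣSize-cong : ∀ m {g h : ℕ → ℤ} → (∀ k → g k ≡ h k) → ΣSize m g ≡ ΣSize m h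
ΣSize-cong m g≗h = ΣSub-cong m (λ A → g≗h ∣ A ∣)

ΣSize-suc : ∀ m h → ΣSize (suc m) h ≡ ΣSize m (λ k → h k +ℤ h (suc k))
ΣSize-suc m h = trans (ΣSub-suc m (λ A → h ∣ A ∣)) (sym (sumBy-+ (λ A → h ∣ A ∣) (λ A → h (suc ∣ A ∣)) (allSubsets m)))

ΣSize-+ : ∀ m g h → ΣSize m (λ k → g k +ℤ h k) ≡ ΣSize m g +ℤ ΣSize m h
ΣSize-+ m g h = sumBy-+ (λ A → g ∣ A ∣) (λ A → h ∣ A ∣) (allSubsets m)

ΣSize-* : ∀ m c h → ΣSize m (λ k → c *ℤ h k) ≡ c *ℤ ΣSize m h
ΣSize-* m c h = sumBy-* c (λ A → h ∣ A ∣) (allSubsets m)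

atZero : ℤ → ℕ → ℤ
atZero c zero    = c
atZero c (suc k) = + 0

ΣSize-atZero : ∀ m c → ΣSize m (atZero c) ≡ c
ΣSize-atZero zero    c = ℤ.+-identityʳ c
ΣSize-atZero (suc m) c = trans (ΣSize-suc m (atZero c))
  (trans (ΣSize-cong m (λ k → ℤ.+-identityʳ (atZero c k))) (ΣSize-atZero m c))

[1+n]C2≡n+nC2 : ∀ n → suc n C 2 ≡ n +ℕ n C 2
[1+n]C2≡n+nC2 n = trans (sym (nCk+nC[k+1]≡[n+1]C[k+1] n 1)) (cong (λ c → c +ℕ n C 2) (nC1≡n n))

altBinom : ℕ → ℕ → ℤ
altBinom j k = sgn k *ℤ + (k C j)

-- Σₖ (m C k) (-1)ᵏ (k C j) = (-1)ʲ (m C j) (1 - 1)^(m - j).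
ΣSize-altBinom : ∀ {j m} → j < m → ΣSize m (altBinom j) ≡ + 0
ΣSize-altBinom {zero} {suc m} _ =
  trans (ΣSize-suc m (altBinom 0)) (trans (ΣSize-cong m cancel) (sumBy-zero (allSubsets m)))
  where
  cancel : ∀ k → altBinom 0 k +ℤ altBinom 0 (suc k) ≡ + 0
  cancel k = opposite (sgn k)
    where
    opposite : ∀ s → s *ℤ + 1 +ℤ (- s) *ℤ + 1 ≡ + 0
    opposite = solve-∀
ΣSize-altBinom {suc j} {suc m} (s≤s j<m) = begin
  ΣSize (suc m) (altBinom (suc j))                         ≡⟨ ΣSize-suc m (altBinom (suc j)) ⟩
  ΣSize m (λ k → altBinom (suc j) k +ℤ altBinom (suc j) (suc k)) ≡⟨ ΣSize-cong m pascal ⟩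
  ΣSize m (λ k → - (+ 1) *ℤ altBinom j k)                   ≡⟨ ΣSize-* m (- (+ 1)) (altBinom j) ⟩
  - (+ 1) *ℤ ΣSize m (altBinom j)                          ≡⟨ cong (- (+ 1) *ℤ_) (ΣSize-altBinom j<m) ⟩
  + 0                                                      ∎
  where
  open ≡-Reasoning
  pascal : ∀ k → altBinom (suc j) k +ℤ altBinom (suc j) (suc k) ≡ - (+ 1) *ℤ altBinom j k
  pascal k rewrite sym (nCk+nC[k+1]≡[n+1]C[k+1] k j) = identity (sgn k) (+ (k C j)) (+ (k C suc j))
    where
    identity : ∀ s x y → s *ℤ y +ℤ (- s) *ℤ (x +ℤ y) ≡ - (+ 1) *ℤ (s *ℤ x)
    identity = solve-∀

alternating : ℕ → List ℤ → ℕ → ℤ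
alternating i []       k = + 0
alternating i (a ∷ as) k = a *ℤ altBinom i k +ℤ alternating (suc i) as k

ΣSize-alternating : ∀ {m} i as → i +ℕ length as ≤ m → ΣSize m (alternating i as) ≡ + 0
ΣSize-alternating {m} i []       _  = sumBy-zero (allSubsets m)
ΣSize-alternating {m} i (a ∷ as) le = begin
  ΣSize m (alternating i (a ∷ as))
    ≡⟨ ΣSize-+ m (λ k → a *ℤ altBinom i k) (alternating (suc i) as) ⟩
  ΣSize m (λ k → a *ℤ altBinom i k) +ℤ ΣSize m (alternating (suc i) as)
    ≡⟨ cong₂ _+ℤ_ (ΣSize-* m a (altBinom i)) (ΣSize-alternating (suc i) as le′) ⟩
  a *ℤ ΣSize m (altBinom i) +ℤ + 0
    ≡⟨ cong (λ x → a *ℤ x +ℤ + 0) (ΣSize-altBinom (ℕ.≤-trans (ℕ.m≤m+n (suc i) (length as)) le′)) ⟩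
  a *ℤ + 0 +ℤ + 0
    ≡⟨ cong (_+ℤ + 0) (ℤ.*-zeroʳ a) ⟩
  + 0 ∎
  where
  open ≡-Reasoning
  le′ : suc i +ℕ length as ≤ m
  le′ = subst (_≤ m) (ℕ.+-suc i (length as)) le

ΣSize-alternating+atZero : ∀ {m} as c → length as ≤ m →
  ΣSize m (λ k → alternating 0 as k +ℤ atZero c k) ≡ c
ΣSize-alternating+atZero {m} as c le = begin
  ΣSize m (λ k → alternating 0 as k +ℤ atZero c k)    ≡⟨ ΣSize-+ m (alternating 0 as) (atZero c) ⟩
  ΣSize m (alternating 0 as) +ℤ ΣSize m (atZero c)    ≡⟨ cong₂ _+ℤ_ (ΣSize-alternating 0 as le) (ΣSize-atZero m c) ⟩
  + 0 +ℤ c                                            ≡⟨ ℤ.+-identityˡ c ⟩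
  c                                                   ∎
  where open ≡-Reasoning

alternatingSum-size∸1 : ∀ {m} → 2 ≤ m →
  ΣSub m (λ A → if 2 ≤ᵇ ∣ A ∣ then sgn ∣ A ∣ *ℤ + (∣ A ∣ ∸ 1) else + 0) ≡ + 1
alternatingSum-size∸1 {m} 2≤m =
  trans (ΣSize-cong m expand) (ΣSize-alternating+atZero (- (+ 1) ∷ + 1 ∷ []) (+ 1) 2≤m)
  where
  expand : ∀ k → (if 2 ≤ᵇ k then sgn k *ℤ + (k ∸ 1) else + 0)
                 ≡ alternating 0 (- (+ 1) ∷ + 1 ∷ []) k +ℤ atZero (+ 1) k
  expand zero          = refl
  expand (suc zero)    = refl
  expand (suc (suc j)) = trans (identity s (+ suc j)) (cong shape (sym (nC1≡n (suc (suc j)))))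
    where
    s = sgn (suc (suc j))
    shape : ℕ → ℤ
    shape c = - (+ 1) *ℤ (s *ℤ + 1) +ℤ (+ 1 *ℤ (s *ℤ + c) +ℤ + 0) +ℤ + 0
    identity : ∀ s a → s *ℤ a ≡ - (+ 1) *ℤ (s *ℤ + 1) +ℤ (+ 1 *ℤ (s *ℤ (+ 1 +ℤ a)) +ℤ + 0) +ℤ + 0
    identity = solve-∀

alternatingSum-[size∸1]C2 : ∀ {m} → 3 ≤ m →
  ΣSub m (λ A → if 3 ≤ᵇ ∣ A ∣ then sgn (∣ A ∣ +ℕ 1) *ℤ + ((∣ A ∣ ∸ 1) C 2) else + 0) ≡ + 1
alternatingSum-[size∸1]C2 {m} 3≤m =
  trans (ΣSize-cong m expand) (ΣSize-alternating+atZero (- (+ 1) ∷ + 1 ∷ - (+ 1) ∷ []) (+ 1) 3≤m)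
  where
  expand : ∀ k → (if 3 ≤ᵇ k then sgn (k +ℕ 1) *ℤ + ((k ∸ 1) C 2) else + 0)
                 ≡ alternating 0 (- (+ 1) ∷ + 1 ∷ - (+ 1) ∷ []) k +ℤ atZero (+ 1) k
  expand zero                = refl
  expand (suc zero)          = refl
  expand (suc (suc zero))    = refl
  expand (suc (suc (suc j))) =
    trans (cong (λ t → sgn t *ℤ + (i C 2)) (ℕ.+-comm (suc i) 1))
          (trans (identity s (+ i) (+ (i C 2))) (cong₂ shape (sym (nC1≡n (suc i))) (sym ([1+n]C2≡n+nC2 i))))
    where
    i = suc (suc j)
    s = sgn (suc i)
    shape : ℕ → ℕ → ℤ
    shape c₁ c₂ = - (+ 1) *ℤ (s *ℤ + 1) +ℤ (+ 1 *ℤ (s *ℤ + c₁) +ℤ (- (+ 1) *ℤ (s *ℤ + c₂) +ℤ + 0)) +ℤ + 0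
    identity : ∀ s a x → (- s) *ℤ x
      ≡ - (+ 1) *ℤ (s *ℤ + 1) +ℤ (+ 1 *ℤ (s *ℤ (+ 1 +ℤ a)) +ℤ (- (+ 1) *ℤ (s *ℤ (a +ℤ x)) +ℤ + 0)) +ℤ + 0
    identity = solve-∀

ΣSub-⊆ : ∀ m (S : Subset m) (φ : ℕ → ℤ) →
  ΣSub m (λ B → if does (B ⊆? S) then φ ∣ B ∣ else + 0) ≡ ΣSize ∣ S ∣ φ
ΣSub-⊆ zero    []          φ = refl
ΣSub-⊆ (suc m) (false ∷ S) φ =
  trans (ΣSub-suc m (λ B → if does (B ⊆? false ∷ S) then φ ∣ B ∣ else + 0))
        (trans (cong₂ _+ℤ_ (ΣSub-⊆ m S φ) (sumBy-zero (allSubsets m))) (ℤ.+-identityʳ _))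
ΣSub-⊆ (suc m) (true ∷ S) φ = begin
  ΣSub (suc m) (λ B → if does (B ⊆? true ∷ S) then φ ∣ B ∣ else + 0)
    ≡⟨ ΣSub-suc m (λ B → if does (B ⊆? true ∷ S) then φ ∣ B ∣ else + 0) ⟩
  ΣSub m (λ B → if does (B ⊆? S) then φ ∣ B ∣ else + 0) +ℤ ΣSub m (λ B → if does (B ⊆? S) then φ (suc ∣ B ∣) else + 0)
    ≡⟨ cong₂ _+ℤ_ (ΣSub-⊆ m S φ) (ΣSub-⊆ m S (λ k → φ (suc k))) ⟩
  ΣSize s φ +ℤ ΣSize s (λ k → φ (suc k))
    ≡⟨ sym (ΣSize-+ s φ (λ k → φ (suc k))) ⟩
  ΣSize s (λ k → φ k +ℤ φ (suc k))
    ≡⟨ sym (ΣSize-suc s φ) ⟩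
  ΣSize (suc s) φ ∎
  where
  open ≡-Reasoning
  s = ∣ S ∣

countSub-≡0 : ∀ m (P : Subset m → Bool) → (∀ S → ¬ T (P S)) → countSub m P ≡ 0
countSub-≡0 zero    P ¬P with P [] in eq
... | true  = ⊥-elim (¬P [] (subst T (sym eq) tt))
... | false = refl
countSub-≡0 (suc m) P ¬P = trans (countSub-suc m P)
  (cong₂ _+ℕ_ (countSub-≡0 m _ (λ S → ¬P (false ∷ S))) (countSub-≡0 m _ (λ S → ¬P (true ∷ S))))

countSub-≡1 : ∀ m (P : Subset m → Bool) S₀ → T (P S₀) → (∀ S → T (P S) → S ≡ S₀) → countSub m P ≡ 1
countSub-≡1 zero    P [] PS₀ unique with P []
... | true = refl
countSub-≡1 (suc m) P (false ∷ S₀) PS₀ unique = trans (countSub-suc m P)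
  (cong₂ _+ℕ_ (countSub-≡1 m _ S₀ PS₀ (λ S PS → Vec.∷-injectiveʳ (unique _ PS)))
              (countSub-≡0 m _ (λ S PS → case Vec.∷-injectiveˡ (unique _ PS) of λ ())))
countSub-≡1 (suc m) P (true ∷ S₀) PS₀ unique = trans (countSub-suc m P)
  (cong₂ _+ℕ_ (countSub-≡0 m _ (λ S PS → case Vec.∷-injectiveˡ (unique _ PS) of λ ()))
              (countSub-≡1 m _ S₀ PS₀ (λ S PS → Vec.∷-injectiveʳ (unique _ PS))))

countSub-remove : ∀ m (P : Subset m → Bool) S₀ → T (P S₀) →
  countSub m P ≡ suc (countSub m (λ S → P S ∧ not (does (S ≟ˢ S₀))))
countSub-remove m P S₀ PS₀ = trans (countBy-split P (λ S → does (S ≟ˢ S₀)) (allSubsets m))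
  (cong (_+ℕ countSub m (λ S → P S ∧ not (does (S ≟ˢ S₀))))
        (countSub-≡1 m _ S₀ (from Bool.T-∧ (PS₀ , from (T-does (S₀ ≟ˢ S₀)) refl))
                     (λ S P∧≡ → to (T-does (S ≟ˢ S₀)) (proj₂ (to Bool.T-∧ P∧≡)))))

3≤countSub : ∀ m (P : Subset m → Bool) {S₁ S₂ S₃} → T (P S₁) → T (P S₂) → T (P S₃) →
  S₁ ≢ S₂ → S₁ ≢ S₃ → S₂ ≢ S₃ → 3 ≤ countSub m P
3≤countSub m P {S₁} {S₂} {S₃} PS₁ PS₂ PS₃ S₁≢S₂ S₁≢S₃ S₂≢S₃ =
  subst (3 ≤_) (sym (countSub-remove m P S₁ PS₁)) (s≤s
  (subst (2 ≤_) (sym (countSub-remove m P₁ S₂ P₁S₂)) (s≤s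
  (subst (1 ≤_) (sym (countSub-remove m P₂ S₃ P₂S₃)) (s≤s z≤n)))))
  where
  keep : ∀ (Q : Subset m → Bool) {S S′} → T (Q S) → S ≢ S′ → T (Q S ∧ not (does (S ≟ˢ S′)))
  keep Q {S} {S′} QS S≢S′ with S ≟ˢ S′
  ... | yes S≡S′ = ⊥-elim (S≢S′ S≡S′)
  ... | no  _    = from Bool.T-∧ (QS , tt)
  P₁ P₂ : Subset m → Bool
  P₁ S = P S ∧ not (does (S ≟ˢ S₁))
  P₂ S = P₁ S ∧ not (does (S ≟ˢ S₂))
  P₁S₂ : T (P₁ S₂)
  P₁S₂ = keep P PS₂ (S₁≢S₂ ∘ sym)
  P₂S₃ : T (P₂ S₃)
  P₂S₃ = keep P₁ (keep P PS₃ (S₁≢S₃ ∘ sym)) (S₂≢S₃ ∘ sym)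

module _ (M : Matroid) where

  rk-⁅⁆≤1 : ∀ e → rk M ⁅ e ⁆ ≤ 1
  rk-⁅⁆≤1 e = subst (rk M ⁅ e ⁆ ≤_) (∣⁅x⁆∣≡1 e) (rk-≤ M ⁅ e ⁆)

  rk-∪≤1 : ∀ {X Y} → rk M X ≤ 1 → rk M Y ≤ 1 → 1 ≤ rk M (X ∩ Y) → rk M (X ∪ Y) ≤ 1
  rk-∪≤1 {X} {Y} rkX≤1 rkY≤1 1≤rkX∩Y = ℕ.+-cancelʳ-≤ 1 (rk M (X ∪ Y)) 1 (begin
    rk M (X ∪ Y) +ℕ 1             ≤⟨ ℕ.+-monoʳ-≤ (rk M (X ∪ Y)) 1≤rkX∩Y ⟩
    rk M (X ∪ Y) +ℕ rk M (X ∩ Y)  ≤⟨ rk-sub M X Y ⟩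
    rk M X +ℕ rk M Y              ≤⟨ ℕ.+-mono-≤ rkX≤1 rkY≤1 ⟩
    2                             ∎)
    where open ℕ.≤-Reasoning

  rank≤rk-∁⁅⁆ : ∀ e → ¬ IsColoop M e → rank M ≤ rk M (∁ ⁅ e ⁆)
  rank≤rk-∁⁅⁆ e notColoop = ℕ.≤-pred (ℕ.≤∧≢⇒< rank≤1+rk∁ (λ rank≡1+rk∁ →
    notColoop (trans (ℕ.+-comm _ 1) (sym rank≡1+rk∁))))
    where
    rank≤1+rk∁ : rank M ≤ suc (rk M (∁ ⁅ e ⁆))
    rank≤1+rk∁ = ℕ.m+n≤o⇒m≤o (rank M) (begin
      rank M +ℕ rk M (⁅ e ⁆ ∩ ∁ ⁅ e ⁆)
        ≡⟨ cong (λ X → rk M X +ℕ rk M (⁅ e ⁆ ∩ ∁ ⁅ e ⁆)) (sym (p∪∁p≡⊤ ⁅ e ⁆)) ⟩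
      rk M (⁅ e ⁆ ∪ ∁ ⁅ e ⁆) +ℕ rk M (⁅ e ⁆ ∩ ∁ ⁅ e ⁆)
        ≤⟨ rk-sub M ⁅ e ⁆ (∁ ⁅ e ⁆) ⟩
      rk M ⁅ e ⁆ +ℕ rk M (∁ ⁅ e ⁆)
        ≤⟨ ℕ.+-monoˡ-≤ _ (rk-⁅⁆≤1 e) ⟩
      suc (rk M (∁ ⁅ e ⁆)) ∎)
      where open ℕ.≤-Reasoning

  rank<n : (∀ e → ¬ IsColoop M e) → 1 ≤ rank M → rank M < n M
  rank<n coloopless 1≤rank = begin-strict
    rank M              ≤⟨ rank≤rk-∁⁅⁆ e (coloopless e) ⟩
    rk M (∁ ⁅ e ⁆)      ≤⟨ rk-≤ M (∁ ⁅ e ⁆) ⟩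
    ∣ ∁ ⁅ e ⁆ ∣         <⟨ p⊂q⇒∣p∣<∣q∣ (⊆⊤ , e , ∈⊤ , λ e∈∁⁅e⁆ → x∈∁p⇒x∉p e∈∁⁅e⁆ (x∈⁅x⁆ e)) ⟩
    ∣ full {n M} ∣       ≡⟨ ∣⊤∣≡n (n M) ⟩
    n M                 ∎
    where
    open ℕ.≤-Reasoning
    e : Fin (n M)
    e = fromℕ< (ℕ.≤-trans 1≤rank (subst (rank M ≤_) (∣⊤∣≡n (n M)) (rk-≤ M full)))

module Loopless (M : Matroid) (loopless : ∀ e → ¬ IsLoop M e) where

  rk-⁅⁆ : ∀ e → rk M ⁅ e ⁆ ≡ 1
  rk-⁅⁆ e = ℕ.≤-antisym (rk-⁅⁆≤1 M e) (ℕ.n≢0⇒n>0 (loopless e))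

  1≤rk : ∀ {A e} → e ∈ A → 1 ≤ rk M A
  1≤rk {A} {e} e∈A = subst (_≤ rk M A) (rk-⁅⁆ e) (rk-mono M (⁅⁆⊆ e∈A))

  parallel?⇔ : ∀ {e f} → T (parallel? M e f) ⇔ rk M (⁅ e ⁆ ∪ ⁅ f ⁆) ≤ 1
  parallel?⇔ {e} {f} = mk⇔
    (λ t → ℕ.≤-reflexive (ℕ.≡ᵇ⇒≡ _ 1 (proj₁ (to Bool.T-∧ t))))
    (λ rk≤1 → subst T (sym (parallel?≡true rk≤1)) tt)
    where
    parallel?≡true : rk M (⁅ e ⁆ ∪ ⁅ f ⁆) ≤ 1 → parallel? M e f ≡ true
    parallel?≡true rk≤1 rewrite ℕ.≤-antisym rk≤1 (1≤rk (x∈p∪q⁺ (inj₁ (x∈⁅x⁆ e)))) | rk-⁅⁆ e | rk-⁅⁆ f = refl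

  -- S is covered by the pairs ⁅ e ⁆ ∪ ⁅ x ⁆ with x ∈ S; they all contain e, so gluing them one
  -- at a time with rk-∪≤1 keeps the rank at most 1.
  pairs⇒rk≤1 : ∀ {S} → (∀ {x y} → x ∈ S → y ∈ S → rk M (⁅ x ⁆ ∪ ⁅ y ⁆) ≤ 1) → rk M S ≤ 1
  pairs⇒rk≤1 {S} pairs with nonempty? S
  ... | no  S=∅ = subst (λ X → rk M X ≤ 1) (sym (Empty-unique S=∅))
                    (ℕ.≤-trans (rk-≤ M ∅) (ℕ.≤-trans (ℕ.≤-reflexive (∣⊥∣≡0 (n M))) z≤n))
  ... | yes (e , e∈S) = ℕ.≤-trans (rk-mono M (λ x∈S → ∈star (∈-allFin _) x∈S)) (rk-star (allFin (n M)))
    where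
    star : List (Fin (n M)) → Subset (n M)
    star []      = ⁅ e ⁆
    star (f ∷ L) = if lookup S f then ⁅ f ⁆ ∪ star L else star L

    e∈star : ∀ L → e ∈ star L
    e∈star []      = x∈⁅x⁆ e
    e∈star (f ∷ L) with lookup S f
    ... | true  = x∈p∪q⁺ (inj₂ (e∈star L))
    ... | false = e∈star L

    rk-star : ∀ L → rk M (star L) ≤ 1
    rk-star []      = rk-⁅⁆≤1 M e
    rk-star (f ∷ L) with lookup S f in Sf
    ... | false = rk-star L
    ... | true  = ℕ.≤-trans (rk-mono M (∪-⊆ (λ x∈⁅f⁆ → x∈p∪q⁺ (inj₁ (x∈p∪q⁺ (inj₂ x∈⁅f⁆)))) (x∈p∪q⁺ ∘ inj₂)))
                    (rk-∪≤1 M (pairs e∈S f∈S) (rk-star L) (1≤rk (x∈p∩q⁺ (x∈p∪q⁺ (inj₁ (x∈⁅x⁆ e)) , e∈star L))))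
      where
      f∈S : f ∈ S
      f∈S = from ∈⇔T-lookup (subst T (sym Sf) tt)

    ∈star : ∀ {L x} → x List.∈ L → x ∈ S → x ∈ star L
    ∈star {f ∷ L} (here refl) x∈S rewrite Vec.[]=⇒lookup x∈S = x∈p∪q⁺ (inj₁ (x∈⁅x⁆ f))
    ∈star {f ∷ L} (there x∈L) x∈S with lookup S f
    ... | true  = x∈p∪q⁺ (inj₂ (∈star x∈L x∈S))
    ... | false = ∈star x∈L x∈S

  pairTest : Subset (n M) → Fin (n M) → Fin (n M) → Bool
  pairTest S x y = not (lookup S x ∧ lookup S y) ∨ parallel? M x y

  T-pairwiseParallel? : ∀ {S} → T (pairwiseParallel? M S) ⇔ (∀ x y → T (pairTest S x y))
  T-pairwiseParallel? {S} = mk⇔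
    (λ t x → to T-every-allFin (to (T-every-allFin {P = everyPartner}) t x))
    (λ h → from (T-every-allFin {P = everyPartner}) (λ x → from T-every-allFin (h x)))
    where
    everyPartner : Fin (n M) → Bool
    everyPartner x = every (pairTest S x) (allFin (n M))

  pairwiseParallel?⇔ : ∀ {S} → T (pairwiseParallel? M S) ⇔ rk M S ≤ 1
  pairwiseParallel?⇔ {S} = mk⇔
    (λ t → pairs⇒rk≤1 λ {x} {y} x∈S y∈S → to (parallel?⇔ {x} {y})
      (to T-not∧∨ (to (T-pairwiseParallel? {S}) t x y) (to ∈⇔T-lookup x∈S) (to ∈⇔T-lookup y∈S)))
    (λ rkS≤1 → from (T-pairwiseParallel? {S}) λ x y → from T-not∧∨ λ Sx Sy → from (parallel?⇔ {x} {y})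
      (ℕ.≤-trans (rk-mono M (∪-⊆ (⁅⁆⊆ (from ∈⇔T-lookup Sx)) (⁅⁆⊆ (from ∈⇔T-lookup Sy)))) rkS≤1))

  nonParallelPair : ∀ {S} → ¬ rk M S ≤ 1 →
    ∃₂ λ x y → x ∈ S × y ∈ S × ¬ rk M (⁅ x ⁆ ∪ ⁅ y ⁆) ≤ 1
  nonParallelPair {S} ¬rk≤1
    with ¬∀⟶∃¬ (n M) (λ x → ∀ y → T (pairTest S x y)) (λ x → all? (λ y → T? (pairTest S x y)))
               (¬rk≤1 ∘ to pairwiseParallel?⇔ ∘ from (T-pairwiseParallel? {S}))
  ... | x , ¬∀y with ¬∀⟶∃¬ (n M) (λ y → T (pairTest S x y)) (λ y → T? (pairTest S x y)) ¬∀y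
  ... | y , ¬xy with ¬T-not∧∨ ¬xy
  ... | Sx , Sy , ¬par = x , y , from ∈⇔T-lookup Sx , from ∈⇔T-lookup Sy , ¬par ∘ from (parallel?⇔ {x} {y})

  record IsParallelClass (S : Subset (n M)) : Set where
    field
      nonempty : Nonempty S
      rk≤1     : rk M S ≤ 1
      maximal  : ∀ {g} → rk M (S ∪ ⁅ g ⁆) ≤ 1 → g ∈ S

  open IsParallelClass

  parallelClass?⇔ : ∀ {S} → T (parallelClass? M S) ⇔ IsParallelClass S
  parallelClass?⇔ {S} = mk⇔
    (λ t → let size , pw , max = decompose t in record
      { nonempty = 1≤∣∣⇒Nonempty S (ℕ.≤ᵇ⇒≤ 1 _ size)
      ; rk≤1     = to pairwiseParallel?⇔ pw
      ; maximal  = λ {g} rk≤1 → from ∈⇔T-lookup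
          (to T-∨not (to T-every-allFin max g) (from pairwiseParallel?⇔ rk≤1)) })
    (λ S-class → let e , e∈S = nonempty S-class in
      from Bool.T-∧ (ℕ.≤⇒≤ᵇ (∈⇒1≤∣∣ e∈S) , from Bool.T-∧ (from pairwiseParallel?⇔ (rk≤1 S-class) ,
        from (T-every-allFin {P = inOrNotAddable}) λ g → from T-∨not λ pw →
          to ∈⇔T-lookup (maximal S-class (to pairwiseParallel?⇔ pw)))))
    where
    decompose : ∀ {a b c} → T (a ∧ b ∧ c) → T a × T b × T c
    decompose t = let ta , tbc = to Bool.T-∧ t in ta , to Bool.T-∧ tbc
    inOrNotAddable : Fin (n M) → Bool
    inOrNotAddable g = lookup S g ∨ not (pairwiseParallel? M (S ∪ ⁅ g ⁆))

  cl : Subset (n M) → Subset (n M)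
  cl B = tabulate (λ x → rk M (B ∪ ⁅ x ⁆) ≤ᵇ 1)

  ∈cl⇔ : ∀ {B x} → x ∈ cl B ⇔ rk M (B ∪ ⁅ x ⁆) ≤ 1
  ∈cl⇔ {B} {x} = mk⇔
    (λ x∈clB → ℕ.≤ᵇ⇒≤ _ 1 (subst T (Vec.lookup∘tabulate _ x) (to ∈⇔T-lookup x∈clB)))
    (λ rk≤1 → from ∈⇔T-lookup (subst T (sym (Vec.lookup∘tabulate _ x)) (ℕ.≤⇒≤ᵇ rk≤1)))

  module _ {B e} (e∈B : e ∈ B) (rkB≤1 : rk M B ≤ 1) where

    B⊆cl : B ⊆ cl B
    B⊆cl x∈B = from ∈cl⇔ (ℕ.≤-trans (rk-mono M (∪-⊆ id (⁅⁆⊆ x∈B))) rkB≤1)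

    rk-cl≤1 : rk M (cl B) ≤ 1
    rk-cl≤1 = pairs⇒rk≤1 λ {x} {y} x∈cl y∈cl → ℕ.≤-trans
      (rk-mono M (∪-⊆ (λ z → x∈p∪q⁺ (inj₁ (x∈p∪q⁺ (inj₂ z)))) (λ z → x∈p∪q⁺ (inj₂ (x∈p∪q⁺ (inj₂ z))))))
      (rk-∪≤1 M (to ∈cl⇔ x∈cl) (to ∈cl⇔ y∈cl)
        (1≤rk (x∈p∩q⁺ (x∈p∪q⁺ (inj₁ e∈B) , x∈p∪q⁺ (inj₁ e∈B)))))

    cl-isParallelClass : IsParallelClass (cl B)
    cl-isParallelClass = record
      { nonempty = e , B⊆cl e∈B
      ; rk≤1     = rk-cl≤1
      ; maximal  = λ rk≤1 → from ∈cl⇔ (ℕ.≤-trans (rk-mono M (∪-⊆ (x∈p∪q⁺ ∘ inj₁ ∘ B⊆cl) (x∈p∪q⁺ ∘ inj₂))) rk≤1)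
      }

  parallelClass≡cl : ∀ {S B e} → IsParallelClass S → e ∈ B → B ⊆ S → S ≡ cl B
  parallelClass≡cl {S} {B} S-class e∈B B⊆S = ⊆-antisym S⊆clB clB⊆S
    where
    S⊆clB : S ⊆ cl B
    S⊆clB x∈S = from ∈cl⇔ (ℕ.≤-trans (rk-mono M (∪-⊆ B⊆S (⁅⁆⊆ x∈S))) (rk≤1 S-class))
    clB⊆S : cl B ⊆ S
    clB⊆S x∈clB = maximal S-class (ℕ.≤-trans (rk-mono M (∪-⊆ S⊆clB (⁅⁆⊆ x∈clB)))
                    (rk-cl≤1 e∈B (ℕ.≤-trans (rk-mono M B⊆S) (rk≤1 S-class))))

  #parallelClasses⊇ : ∀ {B e} → e ∈ B →
    countSub (n M) (λ S → parallelClass? M S ∧ does (B ⊆? S)) ≡ (if rk M B ≤ᵇ 1 then 1 else 0)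
  #parallelClasses⊇ {B} e∈B with rk M B ≤ᵇ 1 in rkB≤ᵇ1
  ... | true  = countSub-≡1 _ _ (cl B)
                  (from Bool.T-∧ (from parallelClass?⇔ (cl-isParallelClass e∈B rkB≤1) ,
                                  from (T-does (B ⊆? cl B)) (B⊆cl e∈B rkB≤1)))
                  (λ S t → let S-class , B⊆S = to Bool.T-∧ t in
                    parallelClass≡cl (to parallelClass?⇔ S-class) e∈B (to (T-does (B ⊆? S)) B⊆S))
    where
    rkB≤1 : rk M B ≤ 1
    rkB≤1 = ℕ.≤ᵇ⇒≤ _ 1 (subst T (sym rkB≤ᵇ1) tt)
  ... | false = countSub-≡0 _ _ λ S t → let S-class , B⊆S = to Bool.T-∧ t in
                  subst T rkB≤ᵇ1 (ℕ.≤⇒≤ᵇ (ℕ.≤-trans (rk-mono M (to (T-does (B ⊆? S)) B⊆S))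
                                                     (rk≤1 (to parallelClass?⇔ S-class))))

  ΣSub-rk≤1 : (φ : ℕ → ℤ) → φ 0 ≡ + 0 →
    ΣSub (n M) (λ A → if rk M A ≤ᵇ 1 then φ ∣ A ∣ else + 0)
      ≡ ΣSub (n M) (λ S → if parallelClass? M S then ΣSize ∣ S ∣ φ else + 0)
  ΣSub-rk≤1 φ φ0≡0 = sym (begin
    ΣSub N (λ S → if parallelClass? M S then ΣSize ∣ S ∣ φ else + 0)
      ≡⟨ ΣSub-cong N sumOverSubsets ⟩
    ΣSub N (λ S → ΣSub N (λ B → if class⊇ S B then φ ∣ B ∣ else + 0))
      ≡⟨ sumBy-comm (λ S B → if class⊇ S B then φ ∣ B ∣ else + 0) (allSubsets N) (allSubsets N) ⟩
    ΣSub N (λ B → ΣSub N (λ S → if class⊇ S B then φ ∣ B ∣ else + 0))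
      ≡⟨ ΣSub-cong N (λ B → sumBy-if (λ S → class⊇ S B) (φ ∣ B ∣) (allSubsets N)) ⟩
    ΣSub N (λ B → φ ∣ B ∣ *ℤ + countSub N (λ S → class⊇ S B))
      ≡⟨ ΣSub-cong N weight ⟩
    ΣSub N (λ A → if rk M A ≤ᵇ 1 then φ ∣ A ∣ else + 0) ∎)
    where
    open ≡-Reasoning
    N = n M

    class⊇ : Subset N → Subset N → Bool
    class⊇ S B = parallelClass? M S ∧ does (B ⊆? S)

    sumOverSubsets : ∀ S → (if parallelClass? M S then ΣSize ∣ S ∣ φ else + 0)
                           ≡ ΣSub N (λ B → if class⊇ S B then φ ∣ B ∣ else + 0)
    sumOverSubsets S with parallelClass? M S
    ... | true  = sym (ΣSub-⊆ N S φ)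
    ... | false = sym (sumBy-zero (allSubsets N))

    weight : ∀ B → φ ∣ B ∣ *ℤ + countSub N (λ S → class⊇ S B) ≡ (if rk M B ≤ᵇ 1 then φ ∣ B ∣ else + 0)
    weight B with ∣ B ∣ in ∣B∣≡ | rk-≤ M B
    ... | zero  | rkB≤0 rewrite ℕ.n≤0⇒n≡0 rkB≤0 | φ0≡0 = ℤ.*-zeroˡ (+ countSub N (λ S → class⊇ S B))
    ... | suc k | _ with 1≤∣∣⇒Nonempty B (subst (1 ≤_) (sym ∣B∣≡) (s≤s z≤n))
    ...   | e , e∈B rewrite #parallelClasses⊇ e∈B with rk M B ≤ᵇ 1
    ...     | true  = ℤ.*-identityʳ (φ (suc k))
    ...     | false = ℤ.*-zeroʳ (φ (suc k))

  ΣSub-rk≤2 : (∀ A → rk M A ≤ 2) → (F : ℕ → ℕ → ℤ) (G D : ℕ → ℤ) (c : ℤ) → D 0 ≡ + 0 →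
    F 0 0 ≡ G 0 +ℤ c →
    (∀ j → F (suc j) 1 ≡ G (suc j) +ℤ D (suc j)) →
    (∀ j → F (suc (suc j)) 2 ≡ G (suc (suc j))) →
    ΣSub (n M) (λ A → F ∣ A ∣ (rk M A))
      ≡ ΣSize (n M) G +ℤ c +ℤ ΣSub (n M) (λ S → if parallelClass? M S then ΣSize ∣ S ∣ D else + 0)
  ΣSub-rk≤2 rk≤2 F G D c D0≡0 F00 F[1+j]1 F[2+j]2 = begin
    ΣSub N (λ A → F ∣ A ∣ (rk M A))
      ≡⟨ ΣSub-cong N split ⟩
    ΣSub N (λ A → (G ∣ A ∣ +ℤ atZero c ∣ A ∣) +ℤ (if rk M A ≤ᵇ 1 then D ∣ A ∣ else + 0))
      ≡⟨ sumBy-+ (λ A → G ∣ A ∣ +ℤ atZero c ∣ A ∣) (λ A → if rk M A ≤ᵇ 1 then D ∣ A ∣ else + 0) (allSubsets N) ⟩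
    ΣSize N (λ k → G k +ℤ atZero c k) +ℤ ΣSub N (λ A → if rk M A ≤ᵇ 1 then D ∣ A ∣ else + 0)
      ≡⟨ cong₂ _+ℤ_ (trans (ΣSize-+ N G (atZero c)) (cong (ΣSize N G +ℤ_) (ΣSize-atZero N c)))
                    (ΣSub-rk≤1 D D0≡0) ⟩
    ΣSize N G +ℤ c +ℤ ΣSub N (λ S → if parallelClass? M S then ΣSize ∣ S ∣ D else + 0) ∎
    where
    open ≡-Reasoning
    N = n M

    split : ∀ A → F ∣ A ∣ (rk M A) ≡ (G ∣ A ∣ +ℤ atZero c ∣ A ∣) +ℤ (if rk M A ≤ᵇ 1 then D ∣ A ∣ else + 0)
    split A with ∣ A ∣ in ∣A∣≡ | rk-≤ M A
    ... | zero  | rkA≤0 rewrite ℕ.n≤0⇒n≡0 rkA≤0 | D0≡0 = trans F00 (sym (ℤ.+-identityʳ _))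
    ... | suc j | rkA≤1+j with 1≤∣∣⇒Nonempty A (subst (1 ≤_) (sym ∣A∣≡) (s≤s z≤n))
    ...   | e , e∈A with rk M A | 1≤rk e∈A | rk≤2 A
    ...     | zero              | ()  | _
    ...     | suc (suc (suc _)) | _   | s≤s (s≤s ())
    ...     | suc zero          | _   | _ = trans (F[1+j]1 j) (cong (_+ℤ D (suc j)) (sym (ℤ.+-identityʳ (G (suc j)))))
    ...     | suc (suc zero)    | _   | _ with rkA≤1+j
    ...       | s≤s (s≤s {n = j′} _) = trans (F[2+j]2 j′) (sym (trans (ℤ.+-identityʳ _) (ℤ.+-identityʳ _)))

  singletonParallelClass⇒3≤p : 2 ≤ rank M → (∀ e → ¬ IsColoop M e) →
    ∀ {S} → IsParallelClass S → ∣ S ∣ < 2 → 3 ≤ p M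
  singletonParallelClass⇒3≤p 2≤rank coloopless {S} S-class ∣S∣<2 with nonempty S-class
  ... | e , e∈S with nonParallelPair {∁ ⁅ e ⁆} (λ rk∁≤1 →
                       ℕ.<⇒≱ 2≤rank (ℕ.≤-trans (rank≤rk-∁⁅⁆ M e (coloopless e)) rk∁≤1))
  ... | f , g , f∈∁⁅e⁆ , g∈∁⁅e⁆ , f∦g =
    3≤countSub (n M) (parallelClass? M) (isClass e) (isClass f) (isClass g)
               (apartFrom-e f∈∁⁅e⁆) (apartFrom-e g∈∁⁅e⁆) (f∦g ∘ sameClass)
    where
    isClass : ∀ x → T (parallelClass? M (cl ⁅ x ⁆))
    isClass x = from parallelClass?⇔ (cl-isParallelClass (x∈⁅x⁆ x) (rk-⁅⁆≤1 M x))

    sameClass : ∀ {x y} → cl ⁅ x ⁆ ≡ cl ⁅ y ⁆ → rk M (⁅ x ⁆ ∪ ⁅ y ⁆) ≤ 1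
    sameClass {x} {y} cl≡ = to ∈cl⇔ (subst (y ∈_) (sym cl≡) (B⊆cl (x∈⁅x⁆ y) (rk-⁅⁆≤1 M y) (x∈⁅x⁆ y)))

    apartFrom-e : ∀ {x} → x ∈ ∁ ⁅ e ⁆ → cl ⁅ e ⁆ ≢ cl ⁅ x ⁆
    apartFrom-e {x} x∈∁⁅e⁆ cl≡ = ℕ.<⇒≱ ∣S∣<2 (2≤∣∣ e∈S x∈S (x∉⁅y⁆⇒x≢y (x∈∁p⇒x∉p x∈∁⁅e⁆) ∘ sym))
      where
      x∈S : x ∈ S
      x∈S = subst (x ∈_) (sym (parallelClass≡cl S-class (x∈⁅x⁆ e) (⁅⁆⊆ e∈S))) (from ∈cl⇔ (sameClass cl≡))

module RankTwo (M : Matroid) (loopless : ∀ e → ¬ IsLoop M e) (rank≡2 : rank M ≡ 2) where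

  open Loopless M loopless
  open IsParallelClass

  rk≤2 : ∀ A → rk M A ≤ 2
  rk≤2 A = ℕ.≤-trans (rk-mono M ⊆⊤) (ℕ.≤-reflexive rank≡2)

  1≤∣parallelClass∣ : ∀ {S} → T (parallelClass? M S) → 1 ≤ ∣ S ∣
  1≤∣parallelClass∣ {S} isClass = ∈⇒1≤∣∣ (proj₂ (nonempty (to (parallelClass?⇔ {S}) isClass)))

  ΣSub-sgn·nullity : 2 ≤ n M → ΣSub (n M) (λ A → sgn (∣ A ∣ +ℕ 1) *ℤ + (∣ A ∣ ∸ rk M A)) ≡ + p M -ℤ + 2
  ΣSub-sgn·nullity 2≤n = begin
    ΣSub (n M) (λ A → sgn (∣ A ∣ +ℕ 1) *ℤ + (∣ A ∣ ∸ rk M A))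
      ≡⟨ ΣSub-rk≤2 rk≤2 (λ k r → sgn (k +ℕ 1) *ℤ + (k ∸ r)) G D (- (+ 2)) refl refl F[1+j]1 F[2+j]2 ⟩
    ΣSize (n M) G +ℤ - (+ 2) +ℤ ΣSub (n M) (λ S → if parallelClass? M S then ΣSize ∣ S ∣ D else + 0)
      ≡⟨ cong₂ (λ x y → x +ℤ - (+ 2) +ℤ y) (ΣSize-alternating 0 (+ 2 ∷ - (+ 1) ∷ []) 2≤n) classes ⟩
    + 0 +ℤ - (+ 2) +ℤ + p M
      ≡⟨ rearrange (+ p M) ⟩
    + p M -ℤ + 2 ∎
    where
    open ≡-Reasoning
    -- G k is F k 2 without truncated subtraction, and D k = F k 1 - F k 2 for k ≥ 1;
    -- likewise in ΣSub-sgn·nullityC2.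
    G D : ℕ → ℤ
    G = alternating 0 (+ 2 ∷ - (+ 1) ∷ [])
    D k = alternating 0 (- (+ 1) ∷ []) k +ℤ atZero (+ 1) k

    rearrange : ∀ x → + 0 +ℤ - (+ 2) +ℤ x ≡ x -ℤ + 2
    rearrange = solve-∀

    F[1+j]1 : ∀ j → sgn (suc j +ℕ 1) *ℤ + (suc j ∸ 1) ≡ G (suc j) +ℤ D (suc j)
    F[1+j]1 j = trans (cong (λ t → sgn t *ℤ + j) (ℕ.+-comm (suc j) 1))
                      (trans (identity s (+ j)) (cong shape (sym (nC1≡n (suc j)))))
      where
      s = sgn (suc j)
      shape : ℕ → ℤ
      shape c = + 2 *ℤ (s *ℤ + 1) +ℤ (- (+ 1) *ℤ (s *ℤ + c) +ℤ + 0) +ℤ (- (+ 1) *ℤ (s *ℤ + 1) +ℤ + 0 +ℤ + 0)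
      identity : ∀ s a → (- s) *ℤ a
        ≡ + 2 *ℤ (s *ℤ + 1) +ℤ (- (+ 1) *ℤ (s *ℤ (+ 1 +ℤ a)) +ℤ + 0) +ℤ (- (+ 1) *ℤ (s *ℤ + 1) +ℤ + 0 +ℤ + 0)
      identity = solve-∀

    F[2+j]2 : ∀ j → sgn (suc (suc j) +ℕ 1) *ℤ + (suc (suc j) ∸ 2) ≡ G (suc (suc j))
    F[2+j]2 j = trans (cong (λ t → sgn t *ℤ + j) (ℕ.+-comm (suc (suc j)) 1))
                      (trans (identity s (+ j)) (cong shape (sym (nC1≡n (suc (suc j))))))
      where
      s = sgn (suc (suc j))
      shape : ℕ → ℤ
      shape c = + 2 *ℤ (s *ℤ + 1) +ℤ (- (+ 1) *ℤ (s *ℤ + c) +ℤ + 0)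
      identity : ∀ s a → (- s) *ℤ a ≡ + 2 *ℤ (s *ℤ + 1) +ℤ (- (+ 1) *ℤ (s *ℤ (+ 2 +ℤ a)) +ℤ + 0)
      identity = solve-∀

    classes : ΣSub (n M) (λ S → if parallelClass? M S then ΣSize ∣ S ∣ D else + 0) ≡ + p M
    classes = trans (ΣSub-cong (n M) one) (ΣSub-indicator (n M) (parallelClass? M))
      where
      one : ∀ S → (if parallelClass? M S then ΣSize ∣ S ∣ D else + 0) ≡ (if parallelClass? M S then + 1 else + 0)
      one S with parallelClass? M S in isClass
      ... | false = refl
      ... | true  = ΣSize-alternating+atZero (- (+ 1) ∷ []) (+ 1) (1≤∣parallelClass∣ {S} (subst T (sym isClass) tt))

  ΣSub-sgn·nullityC2 : 3 ≤ n M →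
    ΣSub (n M) (λ A → sgn ∣ A ∣ *ℤ + ((∣ A ∣ ∸ rk M A) C 2)) ≡ + p M +ℤ + p' M -ℤ + 3
  ΣSub-sgn·nullityC2 3≤n = begin
    ΣSub (n M) (λ A → sgn ∣ A ∣ *ℤ + ((∣ A ∣ ∸ rk M A) C 2))
      ≡⟨ ΣSub-rk≤2 rk≤2 (λ k r → sgn k *ℤ + ((k ∸ r) C 2)) G D (- (+ 3)) refl refl F[1+j]1 F[2+j]2 ⟩
    ΣSize (n M) G +ℤ - (+ 3) +ℤ ΣSub (n M) (λ S → if parallelClass? M S then ΣSize ∣ S ∣ D else + 0)
      ≡⟨ cong₂ (λ x y → x +ℤ - (+ 3) +ℤ y) (ΣSize-alternating 0 (+ 3 ∷ - (+ 2) ∷ + 1 ∷ []) 3≤n) classes ⟩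
    + 0 +ℤ - (+ 3) +ℤ (+ p M +ℤ + p' M)
      ≡⟨ rearrange (+ p M) (+ p' M) ⟩
    + p M +ℤ + p' M -ℤ + 3 ∎
    where
    open ≡-Reasoning
    G D : ℕ → ℤ
    G = alternating 0 (+ 3 ∷ - (+ 2) ∷ + 1 ∷ [])
    D k = alternating 0 (- (+ 2) ∷ + 1 ∷ []) k +ℤ atZero (+ 2) k

    rearrange : ∀ x y → + 0 +ℤ - (+ 3) +ℤ (x +ℤ y) ≡ x +ℤ y -ℤ + 3
    rearrange = solve-∀

    F[1+j]1 : ∀ j → sgn (suc j) *ℤ + ((suc j ∸ 1) C 2) ≡ G (suc j) +ℤ D (suc j)
    F[1+j]1 j = trans (identity s (+ j) (+ (j C 2))) (cong₂ shape (sym (nC1≡n (suc j))) (sym ([1+n]C2≡n+nC2 j)))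
      where
      s = sgn (suc j)
      shape : ℕ → ℕ → ℤ
      shape c₁ c₂ = + 3 *ℤ (s *ℤ + 1) +ℤ (- (+ 2) *ℤ (s *ℤ + c₁) +ℤ (+ 1 *ℤ (s *ℤ + c₂) +ℤ + 0))
                    +ℤ (- (+ 2) *ℤ (s *ℤ + 1) +ℤ (+ 1 *ℤ (s *ℤ + c₁) +ℤ + 0) +ℤ + 0)
      identity : ∀ s a x → s *ℤ x
        ≡ + 3 *ℤ (s *ℤ + 1) +ℤ (- (+ 2) *ℤ (s *ℤ (+ 1 +ℤ a)) +ℤ (+ 1 *ℤ (s *ℤ (a +ℤ x)) +ℤ + 0))
          +ℤ (- (+ 2) *ℤ (s *ℤ + 1) +ℤ (+ 1 *ℤ (s *ℤ (+ 1 +ℤ a)) +ℤ + 0) +ℤ + 0)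
      identity = solve-∀

    F[2+j]2 : ∀ j → sgn (suc (suc j)) *ℤ + ((suc (suc j) ∸ 2) C 2) ≡ G (suc (suc j))
    F[2+j]2 j = trans (identity s (+ j) (+ (j C 2)))
                      (cong₂ shape (sym (nC1≡n (suc (suc j))))
                                   (sym (trans ([1+n]C2≡n+nC2 (suc j)) (cong (suc j +ℕ_) ([1+n]C2≡n+nC2 j)))))
      where
      s = sgn (suc (suc j))
      shape : ℕ → ℕ → ℤ
      shape c₁ c₂ = + 3 *ℤ (s *ℤ + 1) +ℤ (- (+ 2) *ℤ (s *ℤ + c₁) +ℤ (+ 1 *ℤ (s *ℤ + c₂) +ℤ + 0))
      identity : ∀ s a x → s *ℤ x
        ≡ + 3 *ℤ (s *ℤ + 1) +ℤ (- (+ 2) *ℤ (s *ℤ (+ 2 +ℤ a)) +ℤ (+ 1 *ℤ (s *ℤ ((+ 1 +ℤ a) +ℤ (a +ℤ x))) +ℤ + 0))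
      identity = solve-∀

    classes : ΣSub (n M) (λ S → if parallelClass? M S then ΣSize ∣ S ∣ D else + 0) ≡ + p M +ℤ + p' M
    classes = begin
      ΣSub (n M) (λ S → if parallelClass? M S then ΣSize ∣ S ∣ D else + 0)
        ≡⟨ ΣSub-cong (n M) oneOrTwo ⟩
      ΣSub (n M) (λ S → (if parallelClass? M S then + 1 else + 0) +ℤ (if nonTrivial S then + 1 else + 0))
        ≡⟨ sumBy-+ (λ S → if parallelClass? M S then + 1 else + 0) (λ S → if nonTrivial S then + 1 else + 0)
                   (allSubsets (n M)) ⟩
      ΣSub (n M) (λ S → if parallelClass? M S then + 1 else + 0) +ℤ ΣSub (n M) (λ S → if nonTrivial S then + 1 else + 0)
        ≡⟨ cong₂ _+ℤ_ (ΣSub-indicator (n M) (parallelClass? M)) (ΣSub-indicator (n M) nonTrivial) ⟩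
      + p M +ℤ + p' M ∎
      where
      nonTrivial : Subset (n M) → Bool
      nonTrivial S = parallelClass? M S ∧ (2 ≤ᵇ ∣ S ∣)
      oneOrTwo : ∀ S → (if parallelClass? M S then ΣSize ∣ S ∣ D else + 0)
                       ≡ (if parallelClass? M S then + 1 else + 0) +ℤ (if nonTrivial S then + 1 else + 0)
      oneOrTwo S with parallelClass? M S in isClass
      ... | false = refl
      ... | true with ∣ S ∣ | 1≤∣parallelClass∣ {S} (subst T (sym isClass) tt)
      ...   | suc zero    | _ = refl
      ...   | suc (suc k) | _ = ΣSize-alternating+atZero {suc (suc k)} (- (+ 2) ∷ + 1 ∷ []) (+ 2) (s≤s (s≤s z≤n))

  p≡2⇒p'≡2 : (∀ e → ¬ IsColoop M e) → p M ≡ 2 → p' M ≡ 2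
  p≡2⇒p'≡2 coloopless p≡2 = trans (countBy-cong (allSubsets (n M)) nonTrivial≗isClass) p≡2
    where
    nonTrivial≗isClass : ∀ S → parallelClass? M S ∧ (2 ≤ᵇ ∣ S ∣) ≡ parallelClass? M S
    nonTrivial≗isClass S with parallelClass? M S in isClass | 2 ≤ᵇ ∣ S ∣ in 2≤ᵇ∣S∣
    ... | false | _     = refl
    ... | true  | true  = refl
    ... | true  | false = ⊥-elim (ℕ.<⇒≱ (subst (_< 3) (sym p≡2) ℕ.≤-refl)
      (singletonParallelClass⇒3≤p (ℕ.≤-reflexive (sym rank≡2)) coloopless
        (to (parallelClass?⇔ {S}) (subst T (sym isClass) tt))
        (ℕ.≰⇒> λ 2≤∣S∣ → subst T 2≤ᵇ∣S∣ (ℕ.≤⇒≤ᵇ 2≤∣S∣))))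

lemma4p2 : (M : Matroid) → (∀ e → ¬ IsLoop M e) → (∀ e → ¬ IsColoop M e) →
    (rank M ≡ 1 →
      ΣSub (n M) (λ A → if 2 ≤ᵇ ∣ A ∣ then sgn ∣ A ∣ *ℤ + (∣ A ∣ ∸ 1) else + 0) ≡ + 1)
    × (rank M ≡ 1 → 3 ≤ n M →
      ΣSub (n M) (λ A → if 3 ≤ᵇ ∣ A ∣ then sgn (∣ A ∣ +ℕ 1) *ℤ + ((∣ A ∣ ∸ 1) C 2) else + 0) ≡ + 1)
    × (rank M ≡ 2 →
      ΣSub (n M) (λ A → sgn (∣ A ∣ +ℕ 1) *ℤ + (∣ A ∣ ∸ rk M A)) ≡ + p M -ℤ + 2)
    × (rank M ≡ 2 →
      (p M ≡ 2 → ΣSub (n M) (λ A → sgn ∣ A ∣ *ℤ + ((∣ A ∣ ∸ rk M A) C 2)) ≡ + 1)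
      × (p M ≡ 3 → ΣSub (n M) (λ A → sgn ∣ A ∣ *ℤ + ((∣ A ∣ ∸ rk M A) C 2)) ≡ + p' M))
lemma4p2 M loopless coloopless =
    (λ rank≡1 → alternatingSum-size∸1 (rank≡⇒<n rank≡1))
  , (λ _ → alternatingSum-[size∸1]C2)
  , (λ rank≡2 → RankTwo.ΣSub-sgn·nullity M loopless rank≡2 (ℕ.<⇒≤ (rank≡⇒<n rank≡2)))
  , λ rank≡2 → let open RankTwo M loopless rank≡2 in
      (λ p≡2 → trans (ΣSub-sgn·nullityC2 (rank≡⇒<n rank≡2))
                     (cong₂ (λ x y → + x +ℤ + y -ℤ + 3) p≡2 (p≡2⇒p'≡2 coloopless p≡2)))
    , (λ p≡3 → trans (ΣSub-sgn·nullityC2 (rank≡⇒<n rank≡2))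
                     (trans (cong (λ x → + x +ℤ + p' M -ℤ + 3) p≡3) (cancel (+ p' M))))
  where
  rank≡⇒<n : ∀ {r} → rank M ≡ suc r → suc r < n M
  rank≡⇒<n rank≡ = subst (_< n M) rank≡ (rank<n M coloopless (ℕ.≤-trans (s≤s z≤n) (ℕ.≤-reflexive (sym rank≡))))

  cancel : ∀ x → + 3 +ℤ x -ℤ + 3 ≡ x
  cancel = solve-∀
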